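{- Let $n$ be even. Then for the functions $\gamma_{2k}:\mathbb{F}_2^n\to\mathbb{F}_2^n$ it holds that $\gamma_{2k}=\gamma_{2k-n}$ whenever $k\geq n$.
   Context: Let $\mathbbm{1}=(1,\dots,1)\in\mathbb{F}_2^n$, let $\odot$ denote component-wise multiplication of vectors in $\mathbb{F}_2^n$, and let $S:\mathbb{F}_2^n\to\mathbb{F}_2^n$ be the cyclic left shift $S(x_1,\dots,x_n)=(x_2,\dots,x_n,x_1)$. Define $\gamma_0=\mathrm{id}$ and, for $k\geq1$, $\gamma_{2k}(x)=S^{2k}(x)\odot(\mathbbm{1}+S^{2k-1}(x))\odot(\mathbbm{1}+S^{2k-3}(x))\odot\cdots\odot(\mathbbm{1}+S(x))$. -}

module Defs where

open import Data.Bool using (Bool; true; false; _∧_; not)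
open import Data.Nat using (ℕ; zero; suc; _+_; _*_)
open import Data.Vec using (Vec; []; _∷_; _∷ʳ_; zipWith; map; replicate)

-- Vectors in F₂ⁿ are Vec Bool n (true = 1, false = 0).

𝟙 : ∀ {n} → Vec Bool n
𝟙 {n} = replicate n true

_⊙_ : ∀ {n} → Vec Bool n → Vec Bool n → Vec Bool n
_⊙_ = zipWith _∧_

-- 𝟙 + x (addition in F₂ of 1 is negation)
𝟙+ : ∀ {n} → Vec Bool n → Vec Bool n
𝟙+ = map not

S : ∀ {n} → Vec Bool n → Vec Bool n
S []       = []
S (x ∷ xs) = xs ∷ʳ x

S^ : ∀ {n} → ℕ → Vec Bool n → Vec Bool n
S^ zero    x = x
S^ (suc j) x = S (S^ j x)

oddProd : ∀ {n} → ℕ → Vec Bool n → Vec Bool n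
oddProd zero    x = 𝟙
oddProd (suc i) x = 𝟙+ (S^ (2 * i + 1) x) ⊙ oddProd i x

-- γ k x  is  γ_{2k}(x) of the paper: γ₀ = id, γ_{2k}(x) = S^{2k}(x) ⊙ oddProd k x for k ≥ 1
γ : ∀ {n} → ℕ → Vec Bool n → Vec Bool n
γ zero    x = x
γ (suc k) x = S^ (2 * suc k) x ⊙ oddProd (suc k) x

{-# OPTIONS --safe #-}
-- Write n = 2q. Then S^n = id, so the factor 𝟙 + S^{2i+1}(x) of oddProd depends
-- only on i mod q. Since ⊙ is commutative and idempotent, every factor beyond the
-- q-th repeats one already present, so oddProd j x = oddProd q x for j ≥ q. For
-- r ≥ q the two factors of γ_{2(q+r)} and γ_{2r} therefore agree: the shifts
-- differ by S^{2q} = id and both products equal oddProd q x.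

module Submission where

open import Defs
open import Data.Bool using (Bool)
open import Data.Bool.Properties using (∧-assoc; ∧-comm; ∧-idem)
open import Data.List as List using (_++_; [_])
open import Data.List.Properties using (++-assoc; ++-identityʳ; ∷-injective)
open import Data.Nat using (ℕ; zero; suc; _+_; _*_; _∸_; _/_; _≤_; _<′_; ≤′-refl; ≤′-step; z≤n; NonZero; >-nonZero⁻¹)
open import Data.Nat.Divisibility using (_∣_; divides)
open import Data.Nat.DivMod using (m*n/n≡m)
open import Data.Nat.Properties using (+-comm; +-suc; +-identityʳ; m+[n∸m]≡n; m<n+m; <⇒<′; m≤m+n; m≤n⇒m≤1+n; m+n≤o⇒m≤o∸n; m+n≤o⇒n≤o)
open import Data.Nat.Tactic.RingSolver using (solve-∀)
open import Data.Product using (_,_)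
open import Data.Vec using (Vec; []; _∷_; _∷ʳ_; toList)
open import Data.Vec.Properties using (cast-is-id; toList-injective; toList-∷ʳ; length-toList; zipWith-assoc; zipWith-comm; zipWith-idem)
open import Relation.Binary.PropositionalEquality using (_≡_; refl; sym; trans; cong; cong₂; subst; module ≡-Reasoning)

open ≡-Reasoning

variable
  n q i j r : ℕ

S^-+ : ∀ i j (x : Vec Bool n) → S^ (i + j) x ≡ S^ i (S^ j x)
S^-+ zero    j x = refl
S^-+ (suc i) j x = cong S (S^-+ i j x)

S^-suc : ∀ j (x : Vec Bool n) → S^ (suc j) x ≡ S^ j (S x)
S^-suc j x = trans (cong (λ i → S^ i x) (+-comm 1 j)) (S^-+ j 1 x)

-- Tracked on lists, where the lengths m + k and k + m of the two rotations need no cast.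
toList-S^-++ : ∀ ys zs (x : Vec Bool n) → toList x ≡ ys ++ zs →
               toList (S^ (List.length ys) x) ≡ zs ++ ys
toList-S^-++ List.[]        zs x        eq = trans eq (sym (++-identityʳ zs))
toList-S^-++ (a List.∷ ys) zs (b ∷ xs) eq with ∷-injective eq
... | refl , xs≡ys++zs = begin
  toList (S^ (suc (List.length ys)) (b ∷ xs)) ≡⟨ cong toList (S^-suc (List.length ys) (b ∷ xs)) ⟩
  toList (S^ (List.length ys) (xs ∷ʳ b))      ≡⟨ toList-S^-++ ys (zs ++ [ b ]) (xs ∷ʳ b) rotated ⟩
  (zs ++ [ b ]) ++ ys                         ≡⟨ ++-assoc zs [ b ] ys ⟩
  zs ++ b List.∷ ys                           ∎
  where
  rotated : toList (xs ∷ʳ b) ≡ ys ++ zs ++ [ b ]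
  rotated = trans (toList-∷ʳ b xs) (trans (cong (_++ [ b ]) xs≡ys++zs) (++-assoc ys zs [ b ]))

S^-length : (x : Vec Bool n) → S^ n x ≡ x
S^-length {n} x = trans (sym (cast-is-id refl (S^ n x))) (toList-injective refl (S^ n x) x fullTurn)
  where
  fullTurn : toList (S^ n x) ≡ toList x
  fullTurn = subst (λ j → toList (S^ j x) ≡ toList x) (length-toList x)
                   (toList-S^-++ (toList x) List.[] x (sym (++-identityʳ (toList x))))

S^-periodic : ∀ j (x : Vec Bool n) → S^ (j + n) x ≡ S^ j x
S^-periodic {n} j x = trans (S^-+ j n x) (cong (S^ j) (S^-length x))

⊙-assoc : (a b c : Vec Bool n) → (a ⊙ b) ⊙ c ≡ a ⊙ (b ⊙ c)
⊙-assoc = zipWith-assoc ∧-assoc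

⊙-comm : (a b : Vec Bool n) → a ⊙ b ≡ b ⊙ a
⊙-comm = zipWith-comm ∧-comm

⊙-idem : (a : Vec Bool n) → a ⊙ a ≡ a
⊙-idem = zipWith-idem ∧-idem

⊙-swap : (a b c : Vec Bool n) → a ⊙ (b ⊙ c) ≡ b ⊙ (a ⊙ c)
⊙-swap a b c = begin
  a ⊙ (b ⊙ c) ≡⟨ sym (⊙-assoc a b c) ⟩
  (a ⊙ b) ⊙ c ≡⟨ cong (_⊙ c) (⊙-comm a b) ⟩
  (b ⊙ a) ⊙ c ≡⟨ ⊙-assoc b a c ⟩
  b ⊙ (a ⊙ c) ∎

⊙-absorb : (a c : Vec Bool n) → a ⊙ (a ⊙ c) ≡ a ⊙ c
⊙-absorb a c = trans (sym (⊙-assoc a a c)) (cong (_⊙ c) (⊙-idem a))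

oddFactor : ℕ → Vec Bool n → Vec Bool n
oddFactor i x = 𝟙+ (S^ (2 * i + 1) x)

oddFactor-absorbed : (x : Vec Bool n) → i <′ j → oddFactor i x ⊙ oddProd j x ≡ oddProd j x
oddFactor-absorbed {i = i} x ≤′-refl = ⊙-absorb (oddFactor i x) (oddProd i x)
oddFactor-absorbed {i = i} x (≤′-step {j} i<′j) = begin
  oddFactor i x ⊙ (oddFactor j x ⊙ oddProd j x) ≡⟨ ⊙-swap (oddFactor i x) (oddFactor j x) (oddProd j x) ⟩
  oddFactor j x ⊙ (oddFactor i x ⊙ oddProd j x) ≡⟨ cong (oddFactor j x ⊙_) (oddFactor-absorbed x i<′j) ⟩
  oddFactor j x ⊙ oddProd j x                   ∎

oddFactor-periodic : ∀ q i (x : Vec Bool (q * 2)) → oddFactor (q + i) x ≡ oddFactor i x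
oddFactor-periodic q i x =
  cong 𝟙+ (trans (cong (λ j → S^ j x) (exponent q i)) (S^-periodic (2 * i + 1) x))
  where
  exponent : ∀ q i → 2 * (q + i) + 1 ≡ (2 * i + 1) + q * 2
  exponent = solve-∀

oddProd-stable : .{{NonZero q}} → (x : Vec Bool (q * 2)) → q ≤ j → oddProd j x ≡ oddProd q x
oddProd-stable {q} x q≤j = trans (cong (λ j → oddProd j x) (sym (m+[n∸m]≡n q≤j))) (stable _)
  where
  stable : ∀ t → oddProd (q + t) x ≡ oddProd q x
  stable zero    = cong (λ j → oddProd j x) (+-identityʳ q)
  stable (suc t) = begin
    oddProd (q + suc t) x                   ≡⟨ cong (λ j → oddProd j x) (+-suc q t) ⟩
    oddFactor (q + t) x ⊙ oddProd (q + t) x ≡⟨ cong (_⊙ oddProd (q + t) x) (oddFactor-periodic q t x) ⟩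
    oddFactor t x ⊙ oddProd (q + t) x       ≡⟨ oddFactor-absorbed x (<⇒<′ (m<n+m t (>-nonZero⁻¹ q))) ⟩
    oddProd (q + t) x                       ≡⟨ stable t ⟩
    oddProd q x                             ∎

γ-shift : .{{NonZero q}} → (x : Vec Bool (q * 2)) → q ≤ r → γ (q + r) x ≡ γ r x
γ-shift x z≤n = refl
γ-shift {q} {suc r} x q≤r = begin
  γ (q + suc r) x                                    ≡⟨ cong (λ k → γ k x) (+-suc q r) ⟩
  S^ (2 * suc (q + r)) x ⊙ oddProd (suc (q + r)) x   ≡⟨ cong₂ _⊙_ shift (oddProd-stable x (m≤n⇒m≤1+n (m≤m+n q r))) ⟩
  S^ (2 * suc r) x ⊙ oddProd q x                     ≡⟨ cong (S^ (2 * suc r) x ⊙_) (sym (oddProd-stable x q≤r)) ⟩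
  γ (suc r) x                                        ∎
  where
  exponent : ∀ q r → 2 * suc (q + r) ≡ 2 * suc r + q * 2
  exponent = solve-∀
  shift : S^ (2 * suc (q + r)) x ≡ S^ (2 * suc r) x
  shift = trans (cong (λ j → S^ j x) (exponent q r)) (S^-periodic (2 * suc r) x)

lemma3 : (n : ℕ) → 2 ∣ n → (k : ℕ) → n ≤ k →
         (x : Vec Bool n) → γ k x ≡ γ (k ∸ n / 2) x
lemma3 _ (divides zero    refl) k _   x = refl
lemma3 _ (divides q@(suc _) refl) k n≤k x = begin
  γ k x                 ≡⟨ cong (λ j → γ j x) (sym (m+[n∸m]≡n (m+n≤o⇒n≤o q q+q≤k))) ⟩
  γ (q + (k ∸ q)) x     ≡⟨ γ-shift x (m+n≤o⇒m≤o∸n q q+q≤k) ⟩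
  γ (k ∸ q) x           ≡⟨ cong (λ j → γ (k ∸ j) x) (sym (m*n/n≡m q 2)) ⟩
  γ (k ∸ q * 2 / 2) x   ∎
  where
  double : ∀ q → q * 2 ≡ q + q
  double = solve-∀
  q+q≤k : q + q ≤ k
  q+q≤k = subst (_≤ k) (double q) n≤k
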